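{- $\mathsf{RCA}_0$ proves: let $\mathcal{S}$ be a finite set of diagrams and $F$ a diagram such that there is $n$ with $\forall G\,((|G|>n\text{ and }G>F)\Rightarrow G\in\mathrm{ucl}(\mathcal{S}))$. Then $F\ge(D)_r\cup(E)_c$ for some $D,E\in\mathcal{S}$.
   Context: A diagram (Young diagram) is a partition $m_1\ge\cdots\ge m_k>0$ with $k>0$, viewed as left-justified rows of boxes; $|D|$ is the number of boxes. $r_i(D)$ is the length of the $i$th row (0 if none), $c_i(D)$ the length of the $i$th column. $D\le E$ means $r_i(D)\le r_i(E)$ for all $i$; $D<E$ means $D\le E$ and $D\ne E$. $D\cup E$ is the diagram with rows $\max(r_i(D),r_i(E))$. $\mathrm{ucl}(\mathcal{S})=\{E:\exists D\in\mathcal{S},\ D\le E\}$. $(D)_r$ is the diagram with $r_1((D)_r)=\max(r_2(D),1)$ and $r_i((D)_r)=r_i(D)$ for $i>1$; $(D)_c$ is the diagram with $c_1((D)_c)=\max(c_2(D),1)$ and $c_i((D)_c)=c_i(D)$ for $i>1$. -}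

module Defs where

open import Data.Nat using (ℕ; zero; suc; _≤_; _<_; _⊔_; _≤?_)
open import Data.Nat.ListAction using (sum)
open import Data.List using (List; []; _∷_; length; filter; applyUpTo; drop)
open import Data.List.Relation.Unary.All using (All)
open import Data.List.Relation.Unary.Any using (Any)
open import Data.List.Relation.Unary.Linked using (Linked)
open import Data.List.Membership.Propositional using (_∈_)
open import Data.Product using (_×_; ∃-syntax)
open import Relation.Binary.PropositionalEquality using (_≢_)

-- A diagram is represented by its list of row lengths m₁ ≥ ⋯ ≥ mₖ > 0, k > 0.
data NonEmpty : List ℕ → Set where
  nonEmpty : ∀ {x xs} → NonEmpty (x ∷ xs)

record IsDiagram (D : List ℕ) : Set where
  field
    nonempty    : NonEmpty D
    positive    : All (λ m → 0 < m) D
    nonincr     : Linked (λ a b → b ≤ a) D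

size : List ℕ → ℕ
size = sum

-- r i D, with rows indexed from 0 (so (r D 0) is the paper's r₁(D)); 0 if no such row
r : List ℕ → ℕ → ℕ
r []       _       = 0
r (x ∷ _)  zero    = x
r (_ ∷ xs) (suc i) = r xs i

-- c D j (0-indexed): length of column j+1 = number of rows of length ≥ j+1
c : List ℕ → ℕ → ℕ
c D j = length (filter (λ m → suc j ≤? m) D)

conj : List ℕ → List ℕ
conj D = applyUpTo (c D) (r D 0)

_≤D_ : List ℕ → List ℕ → Set
D ≤D E = ∀ i → r D i ≤ r E i

_<D_ : List ℕ → List ℕ → Set
D <D E = (D ≤D E) × (D ≢ E)

_∪D_ : List ℕ → List ℕ → List ℕ
[]       ∪D ys       = ys
(x ∷ xs) ∪D []       = x ∷ xs
(x ∷ xs) ∪D (y ∷ ys) = (x ⊔ y) ∷ (xs ∪D ys)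

InUcl : List (List ℕ) → List ℕ → Set
InUcl S E = ∃[ D ] (D ∈ S × D ≤D E)

rowOp : List ℕ → List ℕ
rowOp D = (r D 1 ⊔ 1) ∷ drop 1 D

-- (D)_c : first column replaced by max(c₂(D),1), i.e. transpose of ((Dᵀ)_r)
colOp : List ℕ → List ℕ
colOp D = conj (rowOp (conj D))

module Submission where

-- Write F = f ∷ fs and let n be the bound from the hypothesis.
-- Two particular diagrams strictly above F have more than n boxes:
--   * G₁ = F with its first row lengthened by n + 1 boxes,
--   * G₂ = F with n + 1 rows of length 1 appended below it.
-- Hence some D ∈ S lies below G₁ and some E ∈ S lies below G₂.
--   * (D)_r ≤ F: rows 2, 3, … of D are bounded by those of G₁, which are the
--     rows of F, and the new first row max(r₂(D),1) is at most r₂(F) ≤ f.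
--   * (E)_c ≤ F: argued box by box.  A box of (E)_c in column j ≥ 2 is a box
--     of E, and a box of E outside the first column is a box of G₂ outside
--     the first column, hence a box of F.  The first column of (E)_c has
--     height max(c₂(E),1), and every such row has a box in column 2 of E.

open import Defs
open import Data.Nat using (ℕ; zero; suc; _+_; _⊔_; _≤_; _<_; z≤n; s≤s; s≤s⁻¹; _≤?_; _<?_)
open import Data.Nat.Properties
open import Data.Nat.ListAction using (sum)
open import Data.Nat.ListAction.Properties using (sum-++)
open import Data.List using (List; []; _∷_; length; applyUpTo; _++_; replicate)
open import Data.List.Properties using (filter-accept; filter-reject; ∷-injectiveˡ; ++-identityʳ-unique)
open import Data.List.Relation.Unary.All using (All; []; _∷_; lookup)
open import Data.List.Membership.Propositional using (_∈_)
import Data.List.Relation.Unary.All.Properties as All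
open import Data.List.Relation.Unary.Linked using (Linked; []; [-]; _∷_; tail)
open import Data.List.Relation.Unary.Linked.Properties using (applyUpTo⁺₂)
open import Data.Product using (_×_; ∃-syntax; _,_)
open import Data.Sum using (_⊎_; inj₁; inj₂)
open import Data.Empty using (⊥-elim)
open import Relation.Nullary using (yes; no; ¬_)
open import Relation.Binary.PropositionalEquality using (_≡_; refl; sym; trans; cong; subst)

Nonincreasing : List ℕ → Set
Nonincreasing = Linked (λ a b → b ≤ a)

-- X has a box in row i, column j (both counted from 0).
HasBox : List ℕ → ℕ → ℕ → Set
HasBox X i j = j < r X i

second≤first : ∀ {x xs} → Nonincreasing (x ∷ xs) → r xs 0 ≤ x
second≤first [-]       = z≤n
second≤first (y≤x ∷ _) = y≤x

firstRow-positive : ∀ {f fs} → IsDiagram (f ∷ fs) → 0 < f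
firstRow-positive dF with IsDiagram.positive dF
... | 0<f ∷ _ = 0<f

≤D-fromBoxes : ∀ A B → (∀ i j → HasBox A i j → HasBox B i j) → A ≤D B
≤D-fromBoxes A B boxes i = rowBound (r A i) (r B i) (boxes i)
  where
  rowBound : ∀ a b → (∀ j → j < a → j < b) → a ≤ b
  rowBound zero    b _ = z≤n
  rowBound (suc a) b h = h a ≤-refl

r-∪D : ∀ A B i → r (A ∪D B) i ≡ r A i ⊔ r B i
r-∪D []      B       i       = refl
r-∪D (x ∷ A) []      i       = sym (⊔-identityʳ (r (x ∷ A) i))
r-∪D (x ∷ A) (y ∷ B) zero    = refl
r-∪D (x ∷ A) (y ∷ B) (suc i) = r-∪D A B i

∪D-least : ∀ A B F → A ≤D F → B ≤D F → (A ∪D B) ≤D F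
∪D-least A B F A≤F B≤F i =
  subst (_≤ r F i) (sym (r-∪D A B i)) (⊔-lub (A≤F i) (B≤F i))

c-cons-long : ∀ {x xs i} → i < x → c (x ∷ xs) i ≡ suc (c xs i)
c-cons-long {x} {xs} {i} i<x = cong length (filter-accept (λ m → suc i ≤? m) {x} {xs} i<x)

c-cons-short : ∀ {x xs i} → ¬ i < x → c (x ∷ xs) i ≡ c xs i
c-cons-short {x} {xs} {i} i≮x = cong length (filter-reject (λ m → suc i ≤? m) {x} {xs} i≮x)

c-vanishes : ∀ {x xs i} → Nonincreasing (x ∷ xs) → x ≤ i → c (x ∷ xs) i ≡ 0
c-vanishes {xs = []}     _            x≤i = c-cons-short (≤⇒≯ x≤i)
c-vanishes {xs = y ∷ ys} (y≤x ∷ mono) x≤i =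
  trans (c-cons-short (≤⇒≯ x≤i)) (c-vanishes mono (≤-trans y≤x x≤i))

column-box : ∀ {X i j} → Nonincreasing X → j < c X i → HasBox X j i
column-box {[]}     _    ()
column-box {x ∷ xs} {i} {j} mono j<c with i <? x
... | no i≮x = ⊥-elim (n≮0 (subst (j <_) (c-vanishes mono (≮⇒≥ i≮x)) j<c))
column-box {x ∷ xs} {i} {zero}  mono j<c | yes i<x = i<x
column-box {x ∷ xs} {i} {suc j} mono j<c | yes i<x =
  column-box (tail mono) (s≤s⁻¹ (subst (suc j <_) (c-cons-long i<x) j<c))

c-antitone : ∀ X i → c X (suc i) ≤ c X i
c-antitone []       i = z≤n
c-antitone (x ∷ xs) i with suc i <? x | i <? x
... | yes p | yes q rewrite c-cons-long {xs = xs} p | c-cons-long {xs = xs} q = s≤s (c-antitone xs i)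
... | yes p | no q  = ⊥-elim (q (<-trans (n<1+n i) p))
... | no p  | yes q rewrite c-cons-short {xs = xs} p | c-cons-long {xs = xs} q = m≤n⇒m≤1+n (c-antitone xs i)
... | no p  | no q  rewrite c-cons-short {xs = xs} p | c-cons-short {xs = xs} q = c-antitone xs i

r-applyUpTo : ∀ (f : ℕ → ℕ) n i → r (applyUpTo f n) i ≤ f i
r-applyUpTo f zero    i       = z≤n
r-applyUpTo f (suc n) zero    = ≤-refl
r-applyUpTo f (suc n) (suc i) = r-applyUpTo (λ k → f (suc k)) n i

conj-nonincreasing : ∀ X → Nonincreasing (conj X)
conj-nonincreasing X = applyUpTo⁺₂ (c X) (r X 0) (c-antitone X)

conj-box : ∀ {X i j} → Nonincreasing X → HasBox (conj X) i j → HasBox X j i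
conj-box {X} {i} mono box = column-box mono (≤-trans box (r-applyUpTo (c X) (r X 0) i))

rowOp-nonincreasing : ∀ {X} → Nonincreasing X → Nonincreasing (rowOp X)
rowOp-nonincreasing []      = [-]
rowOp-nonincreasing [-]     = [-]
rowOp-nonincreasing (_ ∷ l) = m≤m⊔n _ 1 ∷ l

rowOp-lowerBox : ∀ X {i j} → HasBox (rowOp X) (suc i) j → HasBox X (suc i) j
rowOp-lowerBox []      ()
rowOp-lowerBox (_ ∷ _) box = box

colOp-box : ∀ {E i j} → Nonincreasing E → HasBox (colOp E) i j → HasBox (rowOp (conj E)) j i
colOp-box {E} mono = conj-box (rowOp-nonincreasing (conj-nonincreasing E))

rowOp-below : ∀ {f fs} D k → Nonincreasing (f ∷ fs) → 0 < f →
              D ≤D ((f + k) ∷ fs) → rowOp D ≤D (f ∷ fs)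
rowOp-below D        k mono 0<f D≤ zero    = ⊔-lub (≤-trans (D≤ 1) (second≤first mono)) 0<f
rowOp-below []       k mono 0<f D≤ (suc i) = z≤n
rowOp-below (d ∷ ds) k mono 0<f D≤ (suc i) = D≤ (suc i)

r-replicate : ∀ k y i → r (replicate k y) i ≤ y
r-replicate zero    y i       = z≤n
r-replicate (suc k) y zero    = ≤-refl
r-replicate (suc k) y (suc i) = r-replicate k y i

r-++-replicate : ∀ xs k y i → r (xs ++ replicate k y) i ≤ r xs i ⊔ y
r-++-replicate []       k y i       = r-replicate k y i
r-++-replicate (x ∷ xs) k y zero    = m≤m⊔n x y
r-++-replicate (x ∷ xs) k y (suc i) = r-++-replicate xs k y i

<⊔1⇒< : ∀ {j a} → suc j < a ⊔ 1 → suc j < a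
<⊔1⇒< {a = zero}  (s≤s ())
<⊔1⇒< {a = suc a} (s≤s j<a) = s≤s (subst (_ ≤_) (⊔-identityʳ a) j<a)

<⊔1-cases : ∀ {i a} → i < a ⊔ 1 → i ≡ 0 ⊎ i < a
<⊔1-cases {zero}          _ = inj₁ refl
<⊔1-cases {suc i} {zero}  (s≤s ())
<⊔1-cases {suc i} {suc a} i<a⊔1 = inj₂ (<⊔1⇒< i<a⊔1)

-- Only the first column of F ++ ones differs from F.
boxBeyondFirstColumn : ∀ E F k → E ≤D (F ++ replicate k 1) →
                       ∀ {i j} → HasBox E i (suc j) → HasBox F i (suc j)
boxBeyondFirstColumn E F k E≤ {i} box =
  <⊔1⇒< (≤-trans box (≤-trans (E≤ i) (r-++-replicate F k 1 i)))


colOp-below : ∀ E F k → Nonincreasing E → 0 < r F 0 →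
              E ≤D (F ++ replicate k 1) → colOp E ≤D F
colOp-below E F k mono 0<F E≤ = ≤D-fromBoxes (colOp E) F (λ i j box → transposed i j (colOp-box mono box))
  where
  beyond : ∀ {i j} → HasBox E i (suc j) → HasBox F i (suc j)
  beyond = boxBeyondFirstColumn E F k E≤
  transposed : ∀ i j → HasBox (rowOp (conj E)) j i → HasBox F i j
  transposed i zero    box with <⊔1-cases box
  ... | inj₁ refl     = 0<F
  ... | inj₂ inConjE₁ = <⇒≤ (beyond (conj-box mono inConjE₁))
  transposed i (suc j) box = beyond (conj-box mono (rowOp-lowerBox (conj E) box))

firstRowExtension-isDiagram : ∀ {f fs} k → IsDiagram (f ∷ fs) → IsDiagram ((f + k) ∷ fs)
firstRowExtension-isDiagram {f} k dF = record
  { nonempty = nonEmpty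
  ; positive = extendPositive (IsDiagram.positive dF)
  ; nonincr  = extendNonincreasing (IsDiagram.nonincr dF)
  }
  where
  extendPositive : ∀ {xs} → All (0 <_) (f ∷ xs) → All (0 <_) ((f + k) ∷ xs)
  extendPositive (0<f ∷ 0<xs) = ≤-trans 0<f (m≤m+n f k) ∷ 0<xs
  extendNonincreasing : ∀ {xs} → Nonincreasing (f ∷ xs) → Nonincreasing ((f + k) ∷ xs)
  extendNonincreasing [-]          = [-]
  extendNonincreasing (y≤f ∷ mono) = ≤-trans y≤f (m≤m+n f k) ∷ mono

firstRowExtension-size : ∀ f fs k → k ≤ size ((f + k) ∷ fs)
firstRowExtension-size f fs k = ≤-trans (m≤n+m k f) (m≤m+n (f + k) (sum fs))

firstRowExtension-above : ∀ {f fs} k → 0 < k → (f ∷ fs) <D ((f + k) ∷ fs)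
firstRowExtension-above {f} k 0<k =
  (λ { zero → m≤m+n f k ; (suc i) → ≤-refl }) ,
  (λ eq → <-irrefl (∷-injectiveˡ eq) (m<m+n f 0<k))

replicate-nonincreasing : ∀ k y → Nonincreasing (replicate k y)
replicate-nonincreasing zero          y = []
replicate-nonincreasing (suc zero)    y = [-]
replicate-nonincreasing (suc (suc k)) y = ≤-refl ∷ replicate-nonincreasing (suc k) y

++-replicate-nonincreasing : ∀ {xs} k {y} → Nonincreasing xs → All (y ≤_) xs →
                             Nonincreasing (xs ++ replicate k y)
++-replicate-nonincreasing k       []           _          = replicate-nonincreasing k _
++-replicate-nonincreasing zero    [-]          _          = [-]
++-replicate-nonincreasing (suc k) [-]          (y≤x ∷ _)  = y≤x ∷ replicate-nonincreasing (suc k) _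
++-replicate-nonincreasing k       (x≥y ∷ mono) (_ ∷ y≤xs) = x≥y ∷ ++-replicate-nonincreasing k mono y≤xs

appendOnes-isDiagram : ∀ {F} k → IsDiagram F → IsDiagram (F ++ replicate k 1)
appendOnes-isDiagram k dF = record
  { nonempty = appendNonEmpty (IsDiagram.nonempty dF)
  ; positive = All.++⁺ (IsDiagram.positive dF) (All.replicate⁺ k ≤-refl)
  ; nonincr  = ++-replicate-nonincreasing k (IsDiagram.nonincr dF) (IsDiagram.positive dF)
  }
  where
  appendNonEmpty : ∀ {xs ys} → NonEmpty xs → NonEmpty (xs ++ ys)
  appendNonEmpty nonEmpty = nonEmpty

appendOnes-above : ∀ F k → F <D (F ++ replicate (suc k) 1)
appendOnes-above F k = longer F , λ eq → noNil (++-identityʳ-unique F eq)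
  where
  longer : ∀ xs i → r xs i ≤ r (xs ++ replicate (suc k) 1) i
  longer []       i       = z≤n
  longer (x ∷ xs) zero    = ≤-refl
  longer (x ∷ xs) (suc i) = longer xs i
  noNil : ¬ replicate (suc k) 1 ≡ []
  noNil ()

sum-replicate-ones : ∀ k → sum (replicate k 1) ≡ k
sum-replicate-ones zero    = refl
sum-replicate-ones (suc k) = cong suc (sum-replicate-ones k)

appendOnes-size : ∀ F k → k ≤ size (F ++ replicate k 1)
appendOnes-size F k = begin
  k                              ≤⟨ m≤n+m k (sum F) ⟩
  sum F + k                      ≡⟨ cong (sum F +_) (sym (sum-replicate-ones k)) ⟩
  sum F + sum (replicate k 1)    ≡⟨ sym (sum-++ F (replicate k 1)) ⟩
  size (F ++ replicate k 1)      ∎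
  where open ≤-Reasoning

lemma3p6 : (S : List (List ℕ)) → All IsDiagram S →
           (F : List ℕ) → IsDiagram F →
           (∃[ n ] ((G : List ℕ) → IsDiagram G → n < size G → F <D G → InUcl S G)) →
           ∃[ D ] ∃[ E ] (D ∈ S × E ∈ S × ((rowOp D ∪D colOp E) ≤D F))
lemma3p6 S allS []       record { nonempty = () }
lemma3p6 S allS (f ∷ fs) dF (n , bigAboveInUcl)
  with bigAboveInUcl ((f + suc n) ∷ fs) (firstRowExtension-isDiagram (suc n) dF)
                     (firstRowExtension-size f fs (suc n))
                     (firstRowExtension-above (suc n) (s≤s z≤n))
     | bigAboveInUcl ((f ∷ fs) ++ replicate (suc n) 1) (appendOnes-isDiagram (suc n) dF)
                     (appendOnes-size (f ∷ fs) (suc n))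
                     (appendOnes-above (f ∷ fs) n)
... | D , D∈S , D≤G₁ | E , E∈S , E≤G₂ =
  D , E , D∈S , E∈S ,
  ∪D-least (rowOp D) (colOp E) (f ∷ fs)
    (rowOp-below D (suc n) (IsDiagram.nonincr dF) (firstRow-positive dF) D≤G₁)
    (colOp-below E (f ∷ fs) (suc n) (IsDiagram.nonincr (lookup allS E∈S)) (firstRow-positive dF) E≤G₂)
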